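{- For every binary string $S$, $VCdim(S)\leq 2\,\mathbf{alt}(S)$.
   Context: Binary strings (finite or right-infinite) are indexed from $0$. For a finite binary string $s$, let $n(s)=\{i: s_i=1\}\subseteq\mathbb{N}$ (indices relative to $s$). For a binary string $S$, let $\mathfrak{S}=\{n(s): s \text{ a finite contiguous substring of } S\}$. A set $B\subseteq\mathbb{N}$ is shattered if $\{c\cap B: c\in\mathfrak{S}\}$ is the power set of $B$; $VCdim(S)$ is the largest size of a shattered set ($\infty$ if none is largest). $\mathbf{alt}(S)$ denotes the number of maximal contiguous blocks of $1$'s appearing in $S$ (possibly infinite). -}

module Defs where

open import Data.Nat using (ℕ; zero; suc; _+_; _<_; _≤_)
open import Data.Bool using (Bool; true; false)
open import Data.List using (List; []; _∷_; length)
open import Data.Unit using (⊤)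
open import Data.Fin using (Fin)
open import Data.Vec using (Vec; lookup)
open import Data.Product using (Σ; _×_; ∃-syntax)
open import Data.Sum using (_⊎_)
open import Relation.Binary.PropositionalEquality using (_≡_)
open import Function.Definitions using (Injective)
open import Function.Bundles using (_⇔_)

-- A binary string, finite or right-infinite (true = 1, false = 0), indexed from 0.
data BinString : Set where
  fin : List Bool → BinString
  inf : (ℕ → Bool) → BinString

-- Character at position i (positions beyond the end of a finite string read as 0;
-- they are never used as positions of a substring, see Substr).
listAt : List Bool → ℕ → Bool
listAt []       _       = false
listAt (b ∷ bs) zero    = b
listAt (b ∷ bs) (suc i) = listAt bs i

at : BinString → ℕ → Bool
at (fin bs) i = listAt bs i
at (inf f)  i = f i

Substr : BinString → ℕ → ℕ → Set
Substr (fin bs) i m = i + m ≤ length bs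
Substr (inf f)  i m = ⊤

-- b ∈ n(s) where s is the substring of S starting at i of length m.
InN : BinString → ℕ → ℕ → ℕ → Set
InN S i m b = (b < m) × (at S (i + b) ≡ true)

-- B (a finite set of d distinct naturals, given as an injective enumeration)
-- is shattered by the substrings of S: every subset T of B equals c ∩ B
-- for some c = n(s), s a finite contiguous substring of S.
Shattered : BinString → {d : ℕ} → Vec ℕ d → Set
Shattered S {d} B =
  (T : Fin d → Bool) →
  ∃[ i ] ∃[ m ] (Substr S i m ×
    ((j : Fin d) → InN S i m (lookup B j) ⇔ (T j ≡ true)))

BlockStart : BinString → ℕ → Set
BlockStart S zero    = at S zero ≡ true
BlockStart S (suc i) = (at S (suc i) ≡ true) × (at S i ≡ false)

HasAlt : BinString → ℕ → Set
HasAlt S k = Σ (Vec ℕ k) λ P → Injective _≡_ _≡_ (lookup P) ×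
  ((i : ℕ) → BlockStart S i ⇔ (∃[ j ] lookup P j ≡ i))

-- List the shattered set as y₀ < y₁ < … < y_{d-1} and realise the subset {y₀, y₂, y₄, …}
-- by a window of S starting at i.  Reading S with a 0 prepended, the positions
-- -1, i+y₀, i+y₁, …, i+y_{d-1} then carry the values 0,1,0,1,…, and every 0 followed
-- by a 1 forces a maximal block of 1's to start in between.  These ⌈d/2⌉ block starts
-- are distinct, so d ≤ 2 alt(S).
module Submission where

open import Defs
open import Data.Nat using (ℕ; zero; suc; _+_; _*_; _≤_; _<_; z≤n; s≤s; z<s; _≟_)
open import Data.Nat.Properties
  using (≤-trans; ≤-reflexive; <-trans; <-≤-trans; <⇒≤; <⇒≢; >⇒≢; ≤∧≢⇒<;
         m<1+n⇒m≤n; n<1+n; *-suc; *-monoʳ-≤; +-monoʳ-<; ≤-decTotalOrder; ≤-totalOrder;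
         module ≤-Reasoning)
open import Data.Bool using (Bool; true; false; not; if_then_else_)
open import Data.Bool.Properties using (not-involutive; ¬-not)
open import Data.Fin using (Fin)
open import Data.Fin.Properties using (injective⇒≤)
open import Data.Vec using (Vec; lookup)
open import Data.List using (List; []; _∷_; [_]; length; map; tabulate)
import Data.List as List
open import Data.List.Properties using (length-map; length-tabulate)
open import Data.List.Membership.Propositional using (_∈_)
open import Data.List.Membership.Propositional.Properties using (∈-lookup; ∈-tabulate⁻)
open import Data.List.Relation.Unary.Any using (here; there)
open import Data.List.Relation.Unary.All as All using (All; []; _∷_)
import Data.List.Relation.Unary.All.Properties as All
open import Data.List.Relation.Unary.AllPairs as AllPairs using (AllPairs; []; _∷_)
import Data.List.Relation.Unary.AllPairs.Properties as AllPairs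
open import Data.List.Relation.Unary.Unique.Propositional using (Unique)
import Data.List.Relation.Unary.Unique.Propositional.Properties as Unique
open import Data.List.Relation.Binary.Permutation.Propositional using (↭-sym; ↭⇒↭ₛ)
open import Data.List.Relation.Binary.Permutation.Propositional.Properties using (∈-resp-↭; ↭-length)
import Data.List.Relation.Binary.Permutation.Setoid.Properties as Permutation
import Data.List.Relation.Unary.Sorted.TotalOrder.Properties as Sorted
open import Data.List.Sort ≤-decTotalOrder using (sort; sort-↭; sort-↗)
open import Data.Product using (_×_; _,_; proj₁; proj₂; ∃-syntax)
open import Data.Unit using (⊤; tt)
open import Function.Bundles using (_⇔_; Equivalence)
open import Function.Definitions using (Injective)
open import Relation.Nullary using (¬_; does; contradiction)
open import Relation.Nullary.Decidable using (dec-true; dec-false)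
open import Relation.Binary.PropositionalEquality
  using (_≡_; _≢_; refl; sym; trans; cong; subst; setoid; module ≡-Reasoning)

Unique⇒lookup-injective : ∀ {a} {A : Set a} {xs : List A} →
  Unique xs → Injective _≡_ _≡_ (List.lookup xs)
Unique⇒lookup-injective (_ ∷ _) {Fin.zero} {Fin.zero} _ = refl
Unique⇒lookup-injective (x∉xs ∷ _) {Fin.zero} {Fin.suc j} eq =
  contradiction eq (All.lookup x∉xs (∈-lookup j))
Unique⇒lookup-injective (x∉xs ∷ _) {Fin.suc i} {Fin.zero} eq =
  contradiction (sym eq) (All.lookup x∉xs (∈-lookup i))
Unique⇒lookup-injective (_ ∷ unique) {Fin.suc i} {Fin.suc j} eq =
  cong Fin.suc (Unique⇒lookup-injective unique eq)

sortedImage : ∀ {d} (B : Vec ℕ d) → Injective _≡_ _≡_ (lookup B) →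
  ∃[ ys ] AllPairs _<_ ys × length ys ≡ d × (∀ {x} → x ∈ ys → ∃[ j ] x ≡ lookup B j)
sortedImage B injective =
  sort xs , strictlySorted , trans (↭-length (sort-↭ xs)) (length-tabulate (lookup B)) ,
  λ x∈ys → ∈-tabulate⁻ (∈-resp-↭ (sort-↭ xs) x∈ys)
  where
  xs : List ℕ
  xs = tabulate (lookup B)
  unique : Unique (sort xs)
  unique = Permutation.Unique-resp-↭ (setoid ℕ) (↭⇒↭ₛ (↭-sym (sort-↭ xs)))
             (Unique.tabulate⁺ injective)
  strictlySorted : AllPairs _<_ (sort xs)
  strictlySorted = AllPairs.zipWith (λ (x≤y , x≢y) → ≤∧≢⇒< x≤y x≢y)
                     (Sorted.Sorted⇒AllPairs ≤-totalOrder (sort-↗ xs) , unique)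

uniqueBlockStarts≤alt : ∀ {S k} {bs : List ℕ} → HasAlt S k →
  Unique bs → All (BlockStart S) bs → length bs ≤ k
uniqueBlockStarts≤alt {bs = bs} (P , _ , enumerates) unique starts =
  injective⇒≤ index-injective
  where
  indexed : ∀ j → ∃[ j′ ] lookup P j′ ≡ List.lookup bs j
  indexed j = Equivalence.to (enumerates _) (All.lookup starts (∈-lookup j))

  index-injective : Injective _≡_ _≡_ (λ j → proj₁ (indexed j))
  index-injective {j} {j′} eq = Unique⇒lookup-injective unique (begin
    List.lookup bs j              ≡⟨ sym (proj₂ (indexed j)) ⟩
    lookup P (proj₁ (indexed j))  ≡⟨ cong (lookup P) eq ⟩
    lookup P (proj₁ (indexed j′)) ≡⟨ proj₂ (indexed j′) ⟩
    List.lookup bs j′             ∎)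
    where open ≡-Reasoning

-- Prepending a 0 makes every block start, including one at position 0, a 0-to-1 rise.
padded : BinString → ℕ → Bool
padded S zero    = false
padded S (suc n) = at S n

rise⇒blockStart : ∀ S b → padded S b ≡ false → padded S (suc b) ≡ true → BlockStart S b
rise⇒blockStart S zero    _   on = on
rise⇒blockStart S (suc b) off on = on , off

blockStart-between : ∀ S {p q} → p < q → padded S p ≡ false → padded S q ≡ true →
  ∃[ b ] p ≤ b × b < q × BlockStart S b
blockStart-between S {p} {suc q} p<1+q off on with padded S q in q-value
... | false = q , m<1+n⇒m≤n p<1+q , n<1+n q , rise⇒blockStart S q q-value on
... | true =
  let b , p≤b , b<q , start = blockStart-between S p<q off q-value
  in b , p≤b , <-trans b<q (n<1+n q) , start
  where
  p≢q : p ≢ q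
  p≢q refl with () ← trans (sym off) q-value
  p<q : p < q
  p<q = ≤∧≢⇒< (m<1+n⇒m≤n p<1+q) p≢q

-- A trailing unpaired position is left unconstrained: the last y need not lie in the window.
Rises : (ℕ → Bool) → List ℕ → Set
Rises s (p ∷ q ∷ zs) = s p ≡ false × s q ≡ true × Rises s zs
Rises s _            = ⊤

rises⇒blockStarts : ∀ S p zs → AllPairs _<_ (p ∷ zs) → Rises (padded S) (p ∷ zs) →
  ∃[ bs ] AllPairs _<_ bs × All (BlockStart S) bs × All (p ≤_) bs × length zs ≤ 2 * length bs
rises⇒blockStarts S p [] _ _ = [] , [] , [] , [] , z≤n
rises⇒blockStarts S p (q ∷ []) ((p<q ∷ []) ∷ _) (off , on , _)
  with b , p≤b , _ , start ← blockStart-between S p<q off on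
  = [ b ] , [] ∷ [] , start ∷ [] , p≤b ∷ [] , s≤s z≤n
rises⇒blockStarts S p (q ∷ p′ ∷ zs) ((p<q ∷ p<p′ ∷ _) ∷ (q<p′ ∷ _) ∷ sorted) (off , on , rises)
  with b , p≤b , b<q , start ← blockStart-between S p<q off on
     | bs , bs-sorted , starts , p′≤bs , length≤ ← rises⇒blockStarts S p′ zs sorted rises
  = b ∷ bs
  , All.map (<-≤-trans (<-trans b<q q<p′)) p′≤bs ∷ bs-sorted
  , start ∷ starts
  , p≤b ∷ All.map (≤-trans (<⇒≤ p<p′)) p′≤bs
  , ≤-trans (s≤s (s≤s length≤)) (≤-reflexive (sym (*-suc 2 (length bs))))

-- Marks x₀, x₂, x₄, … of a duplicate-free list x₀ ∷ x₁ ∷ ….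
alternate : List ℕ → ℕ → Bool
alternate []       x = false
alternate (y ∷ ys) x = if does (x ≟ y) then true else not (alternate ys x)

alternate-head : ∀ y ys → alternate (y ∷ ys) y ≡ true
alternate-head y ys rewrite dec-true (y ≟ y) refl = refl

alternate-tail : ∀ x y ys → x ≢ y → alternate (y ∷ ys) x ≡ not (alternate ys x)
alternate-tail x y ys x≢y rewrite dec-false (x ≟ y) x≢y = refl

alternate-drop₂ : ∀ x y y′ ys → x ≢ y → x ≢ y′ → alternate (y ∷ y′ ∷ ys) x ≡ alternate ys x
alternate-drop₂ x y y′ ys x≢y x≢y′ =
  trans (alternate-tail x y (y′ ∷ ys) x≢y)
        (trans (cong not (alternate-tail x y′ ys x≢y′)) (not-involutive (alternate ys x)))

window-rises : ∀ S i m ys → AllPairs _<_ ys →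
  (∀ {x} → x ∈ ys → InN S i m x ⇔ (alternate ys x ≡ true)) →
  Rises (padded S) (0 ∷ map (λ y → suc (i + y)) ys)
window-rises S i m [] _ _ = tt
window-rises S i m (y ∷ []) _ realizes =
  refl , proj₂ (Equivalence.from (realizes (here refl)) (alternate-head y [])) , tt
window-rises S i m (y ∷ y′ ∷ []) _ realizes =
  refl , proj₂ (Equivalence.from (realizes (here refl)) (alternate-head y [ y′ ])) , tt
window-rises S i m (y ∷ y′ ∷ y″ ∷ ys) ((y<y′ ∷ y<rest) ∷ (y′<rest@(y′<y″ ∷ _)) ∷ sorted) realizes
  = let _ , on″ , rises = window-rises S i m (y″ ∷ ys) sorted realizes″
    in refl , proj₂ (Equivalence.from (realizes (here refl)) (alternate-head y (y′ ∷ y″ ∷ ys))) ,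
       ¬-not y′-on-absurd , on″ , rises
  where
  realizes″ : ∀ {x} → x ∈ y″ ∷ ys → InN S i m x ⇔ (alternate (y″ ∷ ys) x ≡ true)
  realizes″ {x} x∈rest =
    subst (λ v → InN S i m x ⇔ (v ≡ true))
      (alternate-drop₂ x y y′ (y″ ∷ ys) (>⇒≢ (All.lookup y<rest x∈rest))
                                        (>⇒≢ (All.lookup y′<rest x∈rest)))
      (realizes (there (there x∈rest)))

  y″<m : y″ < m
  y″<m = proj₁ (Equivalence.from (realizes″ (here refl)) (alternate-head y″ ys))

  y′-off : alternate (y ∷ y′ ∷ y″ ∷ ys) y′ ≡ false
  y′-off = trans (alternate-tail y′ y (y′ ∷ y″ ∷ ys) (>⇒≢ y<y′))
                 (cong not (alternate-head y′ (y″ ∷ ys)))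

  y′-on-absurd : ¬ (at S (i + y′) ≡ true)
  y′-on-absurd on′ with () ←
    trans (sym y′-off) (Equivalence.to (realizes (there (here refl))) (<-trans y′<y″ y″<m , on′))

alternatingWindow≤alt : ∀ {S k i m ys} → HasAlt S k → AllPairs _<_ ys →
  (∀ {x} → x ∈ ys → InN S i m x ⇔ (alternate ys x ≡ true)) → length ys ≤ 2 * k
alternatingWindow≤alt {S} {k} {i} {m} {ys} alt sorted realizes =
  let bs , bs-sorted , starts , _ , length≤ =
        rises⇒blockStarts S 0 (map shift ys) shifted-sorted (window-rises S i m ys sorted realizes)
  in begin
    length ys             ≡⟨ sym (length-map shift ys) ⟩
    length (map shift ys) ≤⟨ length≤ ⟩
    2 * length bs         ≤⟨ *-monoʳ-≤ 2 (uniqueBlockStarts≤alt alt (AllPairs.map <⇒≢ bs-sorted) starts) ⟩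
    2 * k                 ∎
  where
  open ≤-Reasoning
  shift : ℕ → ℕ
  shift y = suc (i + y)

  shifted-sorted : AllPairs _<_ (0 ∷ map shift ys)
  shifted-sorted = All.map⁺ (All.universal (λ _ → z<s) ys)
                 ∷ AllPairs.map⁺ (AllPairs.map (λ y<y′ → s≤s (+-monoʳ-< i y<y′)) sorted)

theorem5 : (S : BinString) (k : ℕ) → HasAlt S k →
    (d : ℕ) (B : Vec ℕ d) → Injective _≡_ _≡_ (lookup B) →
    Shattered S B → d ≤ 2 * k
theorem5 S k alt d B injective shattered =
  let ys , sorted , length≡d , ys⊆B = sortedImage B injective
      i , m , _ , window = shattered (λ j → alternate ys (lookup B j))
      realizes : ∀ {x} → x ∈ ys → InN S i m x ⇔ (alternate ys x ≡ true)
      realizes x∈ys = let j , x≡Bj = ys⊆B x∈ys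
                      in subst (λ x → InN S i m x ⇔ (alternate ys x ≡ true)) (sym x≡Bj) (window j)
  in subst (_≤ 2 * k) length≡d (alternatingWindow≤alt alt sorted realizes)
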